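{- Let $\mathcal C\subseteq 2^{[n]}$ be a reduced code and $i\in[n]$. Then $[\mathcal C]$ covers $[\mathcal C^{(i)}]$ in $\mathbf{P}_{\mathbf{Code}}$.
   Context: A code is a subset $\mathcal C\subseteq 2^{[n]}$. For $\sigma\subseteq[n]$, $\mathrm{Tk}_{\mathcal C}(\sigma)=\{c\in\mathcal C\mid\sigma\subseteq c\}$, and $\mathrm{Tk}_{\mathcal C}(j)=\mathrm{Tk}_{\mathcal C}(\{j\})$ (simple trunks). A trunk in $\mathcal C$ is a subset of $\mathcal C$ that is empty or equal to some $\mathrm{Tk}_{\mathcal C}(\sigma)$. A morphism between codes $\mathcal C\subseteq 2^{[n]}$, $\mathcal D\subseteq 2^{[m]}$ is a function $f:\mathcal C\to\mathcal D$ such that the preimage of every trunk in $\mathcal D$ is a trunk in $\mathcal C$; an isomorphism is a bijective morphism whose inverse is a morphism. Given trunks $S_1,\ldots,S_m$ in $\mathcal C$, the morphism determined by them is $c\mapsto\{j\in[m]\mid c\in S_j\}$, $\mathcal C\to 2^{[m]}$ (its image is well defined up to isomorphism regardless of the ordering of the $S_j$). An index $i$ is trivial if $\mathrm{Tk}_{\mathcal C}(i)=\emptyset$, and redundant if $\mathrm{Tk}_{\mathcal C}(i)=\mathrm{Tk}_{\mathcal C}(\sigma)$ for some $\sigma\subseteq[n]\setminus\{i\}$; $\mathcal C$ is reduced if it has no trivial or redundant indices. For a reduced code $\mathcal C\subseteq 2^{[n]}$ with simple trunks $T_j=\mathrm{Tk}_{\mathcal C}(j)$, the $i$-th covered code $\mathcal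 C^{(i)}$ is the image of $\mathcal C$ under the morphism determined by the collection $\{T_j\mid j\neq i\}\cup\{T_j\cap T_i\mid j\neq i,\ T_j\cap T_i\neq T_i\}$. An operation on a code replaces it by one of its trunks (as a code) or by its image under a morphism. For isomorphism classes, $[\mathcal C]\le[\mathcal D]$ if a finite sequence of operations takes $\mathcal D$ to a code isomorphic to $\mathcal C$; this gives the poset $\mathbf{P}_{\mathbf{Code}}$. $[\mathcal C]$ covers $[\mathcal D]$ if $[\mathcal D]<[\mathcal C]$ with nothing strictly in between. -}

module Defs where

open import Data.Nat using (ℕ)
open import Data.Bool using (Bool; true; false; not; _∧_; T)
import Data.Bool as Bool
open import Data.Fin using (Fin)
import Data.Fin as Fin
open import Data.Fin.Subset using (Subset; ⁅_⁆; _∪_; _∉_)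
open import Data.Fin.Subset.Properties using (_⊆?_)
open import Data.List using (List; []; _∷_; map; filter; filterᵇ; allFin; length; lookup; _++_)
open import Data.List.Membership.Propositional using (_∈_)
import Data.List.Membership.DecPropositional as DecMem
open import Data.Vec using (tabulate)
open import Data.Vec.Properties using (≡-dec)
open import Data.Product using (Σ; _×_; _,_)
open import Data.Sum using (_⊎_)
open import Relation.Nullary using (¬_; does)
open import Relation.Binary.PropositionalEquality using (_≡_)
open import Function.Bundles using (_⇔_)

-- A code C ⊆ 2^[n] is represented by a finite list of
-- codewords; only membership matters (all notions below are invariant
-- under reordering / duplication).

Code : ℕ → Set
Code n = List (Subset n)

_≐_ : ∀ {n} → Code n → Code n → Set
C ≐ D = ∀ x → (x ∈ C) ⇔ (x ∈ D)

_≟ˢ_ : ∀ {n} (x y : Subset n) → Relation.Nullary.Dec (x ≡ y)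
_≟ˢ_ = ≡-dec Bool._≟_

_∈ᶜ?_ : ∀ {n} (x : Subset n) (C : Code n) → Relation.Nullary.Dec (x ∈ C)
_∈ᶜ?_ {n} = DecMem._∈?_ (_≟ˢ_ {n})

Tk : ∀ {n} → Code n → Subset n → Code n
Tk C σ = filter (λ c → σ ⊆? c) C

IsTrunk : ∀ {n} → Code n → Code n → Set
IsTrunk {n} C S = (∀ x → ¬ (x ∈ S)) ⊎ Σ (Subset n) (λ σ → S ≐ Tk C σ)

preimage : ∀ {n m} → (Subset n → Subset m) → Code n → Code m → Code n
preimage f C T = filter (λ c → f c ∈ᶜ? T) C

-- f is a morphism C → D : f maps C into D, and the preimage of every
-- trunk in D is a trunk in C.  (f is given on all of 2^[n]; only its
-- values on C matter.)
IsMorphism : ∀ {n m} → Code n → Code m → (Subset n → Subset m) → Set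
IsMorphism C D f =
  (∀ {c} → c ∈ C → f c ∈ D) ×
  (∀ T → IsTrunk D T → IsTrunk C (preimage f C T))

_≅_ : ∀ {n m} → Code n → Code m → Set
_≅_ {n} {m} C D =
  Σ (Subset n → Subset m) λ f → Σ (Subset m → Subset n) λ g →
    IsMorphism C D f × IsMorphism D C g ×
    (∀ {c} → c ∈ C → g (f c) ≡ c) × (∀ {d} → d ∈ D → f (g d) ≡ d)

image : ∀ {n m} → (Subset n → Subset m) → Code n → Code m
image f C = map f C

data Op {n : ℕ} (C : Code n) : {m : ℕ} → Code m → Set where
  trunkOp : (S : Code n) → IsTrunk C S → Op C S
  morphOp : {m : ℕ} (D : Code m) (f : Subset n → Subset m) →
            IsMorphism C D f → Op C (image f C)

data Ops {n : ℕ} (C : Code n) : {m : ℕ} → Code m → Set where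
  done : Ops C C
  step : ∀ {m k} {D : Code m} {E : Code k} → Ops C D → Op D E → Ops C E

_≤ᶜ_ : ∀ {n m} → Code n → Code m → Set
_≤ᶜ_ C D = Σ ℕ λ k → Σ (Code k) λ E → Ops D E × (E ≅ C)

_<ᶜ_ : ∀ {n m} → Code n → Code m → Set
C <ᶜ D = (C ≤ᶜ D) × ¬ (C ≅ D)

Covers : ∀ {n m} → Code n → Code m → Set
Covers C D = (D <ᶜ C) × ¬ (Σ ℕ λ k → Σ (Code k) λ E → (D <ᶜ E) × (E <ᶜ C))

Trivial : ∀ {n} → Code n → Fin n → Set
Trivial C i = ∀ x → ¬ (x ∈ Tk C ⁅ i ⁆)

Redundant : ∀ {n} → Code n → Fin n → Set
Redundant {n} C i = Σ (Subset n) λ σ → (i ∉ σ) × (Tk C ⁅ i ⁆ ≐ Tk C σ)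

Reduced : ∀ {n} → Code n → Set
Reduced C = ∀ i → ¬ Trivial C i × ¬ Redundant C i

-- Morphism determined by trunks Tk_C(σ_1), …, Tk_C(σ_m):
--   c ↦ { k | c ∈ Tk_C(σ_k) } = { k | σ_k ⊆ c }   (for c ∈ C)

determined : ∀ {n} (L : List (Subset n)) → Subset n → Subset (length L)
determined L c = tabulate (λ k → does (lookup L k ⊆? c))

allᵇ : ∀ {n} → (Subset n → Bool) → Code n → Bool
allᵇ p [] = true
allᵇ p (c ∷ C) = p c ∧ allᵇ p C

sameTkᵇ : ∀ {n} → Code n → Subset n → Subset n → Bool
sameTkᵇ C σ τ = allᵇ (λ c → does (does (σ ⊆? c) Bool.≟ does (τ ⊆? c))) C

-- The collection {T_j | j ≠ i} ∪ {T_j ∩ T_i | j ≠ i, T_j ∩ T_i ≠ T_i},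
-- with T_j = Tk_C({j}) and T_j ∩ T_i = Tk_C({i,j}), listed by the σ's.
coveredSigmas : ∀ {n} → Code n → Fin n → List (Subset n)
coveredSigmas {n} C i =
  map ⁅_⁆ js ++
  map (λ j → ⁅ i ⁆ ∪ ⁅ j ⁆)
      (filterᵇ (λ j → not (sameTkᵇ C (⁅ i ⁆ ∪ ⁅ j ⁆) ⁅ i ⁆)) js)
  where
  js : List (Fin n)
  js = filterᵇ (λ j → not (does (j Fin.≟ i))) (allFin n)

covered : ∀ {n} (C : Code n) (i : Fin n) → Code (length (coveredSigmas C i))
covered C i = image (determined (coveredSigmas C i)) C

module Submission where

-- Count the trunks of a code, the empty trunk included.  For a morphism f : C → f(C),
-- pulling back sends distinct trunks of f(C) to distinct trunks of C; for a trunk S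
-- of C, distinct trunks of S are cut out of S by distinct trunks of C.  So no
-- operation increases the count, and one that preserves it yields an isomorphic code,
-- because then every trunk of C arises (forcing f to be injective, resp. S = C).
-- Isomorphic codes have equally many trunks, hence [D] < [C] forces D to have fewer
-- trunks than C.  The trunks of C^(i) pull back to exactly the trunks of C other than
-- Tk_C(i), which is missed because C is reduced; so C^(i) has one trunk fewer than C,
-- leaving no room for a class strictly in between.

open import Defs
open import Data.Bool using (Bool; true; false; T; not; _∧_)
import Data.Bool as Bool
open import Data.Bool.Properties using (T-∧; T-≡; ∧-zeroʳ; ∧-identityʳ)
open import Data.Empty using (⊥-elim)
open import Data.Fin using (Fin; zero; suc)
import Data.Fin as Fin
open import Data.Fin.Properties using (injective⇒≤)
import Data.Fin.Properties as FinP
open import Data.Fin.Subset using (Subset; ⁅_⁆; _∪_; inside; outside)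
  renaming (_∈_ to _∈ˢ_; _∉_ to _∉ˢ_; _⊆_ to _⊆ˢ_; ⊥ to ∅)
open import Data.Fin.Subset.Properties
  using (_⊆?_; ⊆-antisym; ⊆-trans; ⊥⊆; x∈⁅x⁆; x∈⁅y⁆⇒x≡y; p⊆p∪q; q⊆p∪q; x∈p∪q⁻; ∪-idem)
  renaming (_∈?_ to _∈ˢ?_)
open import Data.List using (List; []; _∷_; map; _++_; filterᵇ; allFin; length; lookup; deduplicate)
open import Data.List.Properties using (length-map)
open import Data.List.Membership.Propositional using (_∈_; lose)
open import Data.List.Membership.Propositional.Properties
  using (∈-map⁺; ∈-map⁻; ∈-++⁺ˡ; ∈-++⁺ʳ; ∈-++⁻; ∈-filter⁺; ∈-filter⁻; ∈-allFin; ∈-lookup)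
import Data.List.Membership.Setoid as SetoidMembership
import Data.List.Membership.Setoid.Properties as SetoidMembershipP
import Data.List.Relation.Unary.All as All
import Data.List.Relation.Unary.All.Properties as AllP
open import Data.List.Relation.Unary.AllPairs using ([]; _∷_)
open import Data.List.Relation.Unary.Any as Any using (here; there; any?)
open import Data.List.Relation.Unary.Any.Properties as AnyP using (lookup-index)
import Data.List.Relation.Unary.Unique.Setoid as UniqueSetoid
import Data.List.Relation.Unary.Unique.Setoid.Properties as UniqueP
open import Data.List.Relation.Unary.Unique.DecSetoid.Properties using (deduplicate-!)
open import Data.Maybe using (Maybe; nothing; just)
open import Data.Nat using (ℕ; zero; suc; _≤_; _<_; s≤s⁻¹)
open import Data.Nat.Properties using (≤-antisym; ≤-refl; ≤-trans; ≤∧≢⇒<; <-irrefl; 1+n≰n; 1+n≢n)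
open import Data.Product using (∃; ∃-syntax; _×_; _,_; proj₁; proj₂)
open import Data.Product.Function.NonDependent.Propositional using (_×-⇔_)
open import Data.Sum using (_⊎_; inj₁; inj₂; [_,_])
open import Data.Unit using (tt)
open import Data.Vec using (tabulate)
import Data.Vec as Vec
open import Data.Vec.Properties using (lookup∘tabulate; []=⇒lookup; lookup⇒[]=)
open import Function using (_∘_; id; const)
open import Function.Bundles using (_⇔_; mk⇔; Equivalence)
open import Function.Construct.Composition using (_⇔-∘_)
open import Function.Construct.Identity using (⇔-id)
open import Function.Construct.Symmetry using (⇔-sym)
open import Level using (Level; 0ℓ; _⊔_)
open import Relation.Binary.Bundles using (Setoid; DecSetoid)
open import Relation.Binary.Definitions using (Decidable)
open import Relation.Binary.PropositionalEquality using (_≡_; _≢_; refl; sym; trans; cong; subst; module ≡-Reasoning)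
open import Relation.Nullary using (¬_; ¬?; Dec; yes; no; does; _×-dec_; contradiction)
open import Relation.Nullary.Decidable using (map′; does-⇔; decidable-stable; T?)

open Equivalence using (to; from)
open ≡-Reasoning

private
  variable
    a b ℓ ℓ₁ ℓ₂ : Level
    n m k : ℕ

-- Counting equivalence classes

module _ (S : Setoid a ℓ) where
  open Setoid S using (_≈_) renaming (sym to ≈-sym)
  open SetoidMembership S using () renaming (_∈_ to _∈ₛ_)
  open UniqueSetoid S using (Unique)

  Unique-lookup-injective : ∀ {xs} → Unique xs → ∀ p q → lookup xs p ≈ lookup xs q → p ≡ q
  Unique-lookup-injective (_ ∷ _) zero zero _ = refl
  Unique-lookup-injective (x≉ ∷ _) zero (suc q) x≈ = contradiction x≈ (All.lookup x≉ (∈-lookup q))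
  Unique-lookup-injective (x≉ ∷ _) (suc p) zero x≈ = contradiction (≈-sym x≈) (All.lookup x≉ (∈-lookup p))
  Unique-lookup-injective (_ ∷ xs!) (suc p) (suc q) x≈ = cong suc (Unique-lookup-injective xs! p q x≈)

  Unique-⊆⇒length≤ : ∀ {xs ys} → Unique xs → (∀ {x} → x ∈ₛ xs → x ∈ₛ ys) → length xs ≤ length ys
  Unique-⊆⇒length≤ {xs} {ys} xs! xs⊆ys = injective⇒≤ {f = position} position-injective
    where
    position : Fin (length xs) → Fin (length ys)
    position p = Any.index (xs⊆ys (SetoidMembershipP.∈-lookup S xs p))

    position-injective : ∀ {p q} → position p ≡ position q → p ≡ q
    position-injective {p} {q} same = Unique-lookup-injective xs! p q
      (SetoidMembershipP.index-injective S (xs⊆ys _) (xs⊆ys _) same)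

classCount : (S : DecSetoid a ℓ) → List (DecSetoid.Carrier S) → ℕ
classCount S xs = length (deduplicate (DecSetoid._≟_ S) xs)

module _ (S : DecSetoid a ℓ) where
  open DecSetoid S using (setoid; _≟_; Carrier) renaming (refl to ≈-refl; sym to ≈-sym; trans to ≈-trans)
  open SetoidMembership setoid using () renaming (_∈_ to _∈ₛ_)

  Enumerates : List Carrier → Set a
  Enumerates xs = ∀ x → x ∈ xs

  ∈-deduplicate : ∀ {x xs} → x ∈ xs → x ∈ₛ deduplicate _≟_ xs
  ∈-deduplicate x∈xs = SetoidMembershipP.∈-deduplicate⁺ setoid _≟_
    (λ z≈y x≈y → ≈-trans x≈y (≈-sym z≈y)) (Any.map (λ { refl → ≈-refl }) x∈xs)

module _ (S : DecSetoid a ℓ₁) (T : DecSetoid b ℓ₂) (f : DecSetoid.Carrier S → DecSetoid.Carrier T) where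
  private
    module S = DecSetoid S
    module T = DecSetoid T
  open SetoidMembership T.setoid using () renaming (_∈_ to _∈ₜ_)

  Reflecting : Set (a ⊔ ℓ₁ ⊔ ℓ₂)
  Reflecting = ∀ {x y} → f x T.≈ f y → x S.≈ y

  module _ (reflecting : Reflecting) {xs : List S.Carrier} {ys : List T.Carrier}
           (ys-complete : Enumerates T ys) where
    private
      image-unique : UniqueSetoid.Unique T.setoid (map f (deduplicate S._≟_ xs))
      image-unique = UniqueP.map⁺ S.setoid T.setoid reflecting (deduplicate-! S xs)

    classCount-≤ : classCount S xs ≤ classCount T ys
    classCount-≤ = subst (_≤ classCount T ys) (length-map f (deduplicate S._≟_ xs))
      (Unique-⊆⇒length≤ T.setoid image-unique (λ {y} _ → ∈-deduplicate T (ys-complete y)))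

    classCount-< : ∀ y₀ → (∀ x → ¬ y₀ T.≈ f x) → classCount S xs < classCount T ys
    classCount-< y₀ y₀∉image = subst (λ c → suc c ≤ classCount T ys) (length-map f (deduplicate S._≟_ xs))
      (Unique-⊆⇒length≤ T.setoid (AllP.map⁺ (All.tabulate (λ _ → y₀∉image _)) ∷ image-unique)
        (λ {y} _ → ∈-deduplicate T (ys-complete y)))

  classCount-≤-suc : (∀ {x y} → x S.≈ y → f x T.≈ f y) → ∀ {xs ys} → Enumerates S xs →
                     ∀ y₀ → (∀ y → y T.≈ y₀ ⊎ ∃ λ x → y T.≈ f x) →
                     classCount T ys ≤ suc (classCount S xs)
  classCount-≤-suc f-cong {xs} {ys} xs-complete y₀ y₀-or-image =
    subst (λ c → classCount T ys ≤ suc c) (length-map f (deduplicate S._≟_ xs))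
      (Unique-⊆⇒length≤ T.setoid (deduplicate-! T ys) (λ {y} _ → ∈-candidates y))
    where
    ∈-candidates : ∀ y → y ∈ₜ (y₀ ∷ map f (deduplicate S._≟_ xs))
    ∈-candidates y with y₀-or-image y
    ... | inj₁ y≈y₀ = here y≈y₀
    ... | inj₂ (x , y≈fx) = there (AnyP.map⁺ (Any.map (λ x≈x′ → T.trans y≈fx (f-cong x≈x′))
                              (∈-deduplicate S (xs-complete x))))

  classCount-≡⇒surjective : Reflecting → ∀ {xs ys} → Enumerates S xs → Enumerates T ys →
                            classCount S xs ≡ classCount T ys → ∀ y → ∃ λ x → y T.≈ f x
  classCount-≡⇒surjective reflecting {xs} xs-complete ys-complete same y
    with any? (λ x → y T.≟ f x) xs
  ... | yes hit = Any.satisfied hit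
  ... | no miss = contradiction
    (classCount-< reflecting {xs} ys-complete y λ x y≈fx → miss (lose (xs-complete x) y≈fx))
    (<-irrefl same)

T-does⇔ : ∀ {A : Set} (a? : Dec A) → T (does a?) ⇔ A
T-does⇔ (yes a) = mk⇔ (const a) (const tt)
T-does⇔ (no ¬a) = mk⇔ (λ ()) ¬a

T-⇔⇒≡ : ∀ {a b} → T a ⇔ T b → a ≡ b
T-⇔⇒≡ {false} {false} _ = refl
T-⇔⇒≡ {false} {true} a⇔b = ⊥-elim (from a⇔b tt)
T-⇔⇒≡ {true} {false} a⇔b = ⊥-elim (to a⇔b tt)
T-⇔⇒≡ {true} {true} _ = refl

T-not⇔¬T : ∀ {b} → T (not b) ⇔ (¬ T b)
T-not⇔¬T {false} = mk⇔ (λ _ ()) (const tt)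
T-not⇔¬T {true} = mk⇔ (λ ()) (λ ¬t → ¬t tt)

T-allᵇ⇔ : ∀ p (C : Code n) → T (allᵇ p C) ⇔ (∀ c → c ∈ C → T (p c))
T-allᵇ⇔ p [] = mk⇔ (λ _ _ ()) (const tt)
T-allᵇ⇔ p (c ∷ C) = mk⇔
  (λ t → let t-c , t-C = to T-∧ t in λ where
    _ (here refl) → t-c
    c′ (there c′∈C) → to (T-allᵇ⇔ p C) t-C c′ c′∈C)
  (λ all → from T-∧ (all c (here refl) , from (T-allᵇ⇔ p C) λ c′ c′∈C → all c′ (there c′∈C)))

⁅⁆⊆⇔∈ : ∀ {j : Fin n} {c} → ⁅ j ⁆ ⊆ˢ c ⇔ j ∈ˢ c
⁅⁆⊆⇔∈ {j = j} = mk⇔ (λ ⁅j⁆⊆c → ⁅j⁆⊆c (x∈⁅x⁆ j))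
  (λ j∈c {i} i∈⁅j⁆ → subst (_∈ˢ _) (sym (x∈⁅y⁆⇒x≡y j i∈⁅j⁆)) j∈c)

∪⊆⇔ : ∀ {σ τ c : Subset n} → σ ∪ τ ⊆ˢ c ⇔ (σ ⊆ˢ c × τ ⊆ˢ c)
∪⊆⇔ {σ = σ} {τ} {c} = mk⇔ ∪-bounds ∪-least
  where
  ∪-bounds : σ ∪ τ ⊆ˢ c → σ ⊆ˢ c × τ ⊆ˢ c
  ∪-bounds σ∪τ⊆c = ⊆-trans (p⊆p∪q τ) σ∪τ⊆c , ⊆-trans (q⊆p∪q σ τ) σ∪τ⊆c

  ∪-least : σ ⊆ˢ c × τ ⊆ˢ c → σ ∪ τ ⊆ˢ c
  ∪-least (σ⊆c , τ⊆c) x∈σ∪τ = [ σ⊆c , τ⊆c ] (x∈p∪q⁻ σ τ x∈σ∪τ)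

∈-tabulate⇔ : ∀ {f : Fin n → Bool} {p} → p ∈ˢ tabulate f ⇔ T (f p)
∈-tabulate⇔ {f = f} {p} = mk⇔
  (λ p∈ → from T-≡ (trans (sym (lookup∘tabulate f p)) ([]=⇒lookup p∈)))
  (λ t → lookup⇒[]= p (tabulate f) (trans (lookup∘tabulate f p) (to T-≡ t)))

allSubsets : ∀ n → List (Subset n)
allSubsets zero = Vec.[] ∷ []
allSubsets (suc n) = map (inside Vec.∷_) (allSubsets n) ++ map (outside Vec.∷_) (allSubsets n)

∈-allSubsets : (s : Subset n) → s ∈ allSubsets n
∈-allSubsets Vec.[] = here refl
∈-allSubsets (inside Vec.∷ s) = ∈-++⁺ˡ (∈-map⁺ (inside Vec.∷_) (∈-allSubsets s))
∈-allSubsets {suc n} (outside Vec.∷ s) =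
  ∈-++⁺ʳ (map (inside Vec.∷_) (allSubsets n)) (∈-map⁺ (outside Vec.∷_) (∈-allSubsets s))

-- Trunks and their number

-- `nothing` names the empty trunk and `just σ` names Tk(σ).
Key : ℕ → Set
Key n = Maybe (Subset n)

_∈ᵏ_ : Subset n → Key n → Bool
c ∈ᵏ nothing = false
c ∈ᵏ just σ = does (σ ⊆? c)

_≈[_]_ : Key n → Code n → Key n → Set
k ≈[ C ] k′ = ∀ c → c ∈ C → c ∈ᵏ k ≡ c ∈ᵏ k′

≈[]-dec : (C : Code n) → Decidable _≈[ C ]_
≈[]-dec C k k′ = map′
  (λ same c c∈C → All.lookup same c∈C) (λ same → All.tabulate (same _))
  (All.all? (λ c → c ∈ᵏ k Bool.≟ c ∈ᵏ k′) C)

trunkSetoid : Code n → DecSetoid 0ℓ 0ℓ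
trunkSetoid {n} C = record
  { Carrier = Key n
  ; _≈_ = _≈[ C ]_
  ; isDecEquivalence = record
    { isEquivalence = record
      { refl = λ _ _ → refl
      ; sym = λ k≈k′ c c∈C → sym (k≈k′ c c∈C)
      ; trans = λ k≈k′ k′≈k″ c c∈C → trans (k≈k′ c c∈C) (k′≈k″ c c∈C)
      }
    ; _≟_ = ≈[]-dec C
    }
  }

keys : ∀ n → List (Key n)
keys n = nothing ∷ map just (allSubsets n)

∈-keys : (k : Key n) → k ∈ keys n
∈-keys nothing = here refl
∈-keys (just σ) = there (∈-map⁺ just (∈-allSubsets σ))

trunkCount : Code n → ℕ
trunkCount {n} C = classCount (trunkSetoid C) (keys n)

record Names (C : Code n) (κ : Key n) (S : Code n) : Set where
  constructor names
  field ∈⇔ : ∀ x → x ∈ S ⇔ (x ∈ C × T (x ∈ᵏ κ))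
open Names

Names⇒∈⇔ : ∀ {C S : Code n} {κ x} → Names C κ S → x ∈ C → x ∈ S ⇔ T (x ∈ᵏ κ)
Names⇒∈⇔ {x = x} S-named x∈C = mk⇔ (proj₂ ∘ to (∈⇔ S-named x)) (λ t → from (∈⇔ S-named x) (x∈C , t))

Tk-Names : ∀ (C : Code n) σ → Names C (just σ) (Tk C σ)
Tk-Names C σ = names λ x → mk⇔
  (λ x∈Tk → let x∈C , σ⊆x = ∈-filter⁻ (σ ⊆?_) x∈Tk in x∈C , from (T-does⇔ (σ ⊆? x)) σ⊆x)
  (λ (x∈C , σ⊆x) → ∈-filter⁺ (σ ⊆?_) x∈C (to (T-does⇔ (σ ⊆? x)) σ⊆x))

IsTrunk⇒Names : ∀ {C S : Code n} → IsTrunk C S → ∃[ κ ] Names C κ S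
IsTrunk⇒Names (inj₁ S-empty) = nothing , names λ x → mk⇔ (⊥-elim ∘ S-empty x) (λ ())
IsTrunk⇒Names {C = C} (inj₂ (σ , S≐Tk)) = just σ , names λ x → ∈⇔ (Tk-Names C σ) x ⇔-∘ S≐Tk x

Names⇒IsTrunk : ∀ {C S : Code n} {κ} → Names C κ S → IsTrunk C S
Names⇒IsTrunk {κ = nothing} S-named = inj₁ (λ x → proj₂ ∘ to (∈⇔ S-named x))
Names⇒IsTrunk {C = C} {κ = just σ} S-named =
  inj₂ (σ , λ x → ⇔-sym (∈⇔ (Tk-Names C σ) x) ⇔-∘ ∈⇔ S-named x)

≈⇒Tk≐ : ∀ {C : Code n} {σ τ} → just σ ≈[ C ] just τ → Tk C σ ≐ Tk C τ
≈⇒Tk≐ {C = C} same x = mk⇔ (transport same) (transport λ c c∈C → sym (same c c∈C))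
  where
  transport : ∀ {σ τ} → just σ ≈[ C ] just τ → x ∈ Tk C σ → x ∈ Tk C τ
  transport {σ} {τ} same x∈Tkσ = let x∈C , t = to (∈⇔ (Tk-Names C σ) x) x∈Tkσ in
    from (∈⇔ (Tk-Names C τ) x) (x∈C , subst T (same x x∈C) t)

Tk-sandwich : ∀ {C : Code n} {σ ρ τ} → σ ⊆ˢ ρ → ρ ⊆ˢ τ → just σ ≈[ C ] just τ → just ρ ≈[ C ] just σ
Tk-sandwich {σ = σ} {ρ} {τ} σ⊆ρ ρ⊆τ same c c∈C = T-⇔⇒≡ (mk⇔
  (λ t → from (T-does⇔ (σ ⊆? c)) (⊆-trans σ⊆ρ (to (T-does⇔ (ρ ⊆? c)) t)))
  (λ t → from (T-does⇔ (ρ ⊆? c)) (⊆-trans ρ⊆τ (to (T-does⇔ (τ ⊆? c)) (subst T (same c c∈C) t)))))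

T-sameTkᵇ⇔ : ∀ (C : Code n) σ τ → T (sameTkᵇ C σ τ) ⇔ just σ ≈[ C ] just τ
T-sameTkᵇ⇔ C σ τ = mk⇔
  (λ t c c∈C → to (T-does⇔ (c ∈ᵏ just σ Bool.≟ c ∈ᵏ just τ)) (to (T-allᵇ⇔ _ C) t c c∈C))
  (λ same → from (T-allᵇ⇔ _ C) λ c c∈C →
    from (T-does⇔ (c ∈ᵏ just σ Bool.≟ c ∈ᵏ just τ)) (same c c∈C))

Subset-ext : ∀ {c c′ : Subset n} → (∀ j → c ∈ᵏ just ⁅ j ⁆ ≡ c′ ∈ᵏ just ⁅ j ⁆) → c ≡ c′
Subset-ext same = ⊆-antisym (⊆-from same) (⊆-from (sym ∘ same))
  where
  ⊆-from : ∀ {c c′ : Subset n} → (∀ j → c ∈ᵏ just ⁅ j ⁆ ≡ c′ ∈ᵏ just ⁅ j ⁆) → c ⊆ˢ c′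
  ⊆-from {c = c} {c′} same {j} j∈c = to ⁅⁆⊆⇔∈
    (to (T-does⇔ (⁅ j ⁆ ⊆? c′)) (subst T (same j) (from (T-does⇔ (⁅ j ⁆ ⊆? c)) (from ⁅⁆⊆⇔∈ j∈c))))

-- Morphisms pull trunk names back

MapsInto : Code n → Code m → (Subset n → Subset m) → Set
MapsInto C D f = ∀ {c} → c ∈ C → f c ∈ D

Onto : Code n → Code m → (Subset n → Subset m) → Set
Onto C D f = ∀ {d} → d ∈ D → ∃[ c ] c ∈ C × f c ≡ d

record Pulls (C : Code n) (f : Subset n → Subset m) (φ : Key m → Key n) : Set where
  constructor mkPulls
  field pull : ∀ c → c ∈ C → ∀ k → f c ∈ᵏ k ≡ c ∈ᵏ φ k
open Pulls

∈-preimage⇔ : ∀ f (C : Code n) (S : Code m) {x} → x ∈ preimage f C S ⇔ (x ∈ C × f x ∈ S)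
∈-preimage⇔ f C S = mk⇔ (∈-filter⁻ (λ c → f c ∈ᶜ? S))
  (λ (x∈C , fx∈S) → ∈-filter⁺ (λ c → f c ∈ᶜ? S) x∈C fx∈S)

Pulls⇒IsMorphism : ∀ {C : Code n} {D : Code m} {f φ} → MapsInto C D f → Pulls C f φ → IsMorphism C D f
Pulls⇒IsMorphism {C = C} {D} {f} {φ} into f-pulls = into , λ S S-trunk →
  let κ , S-named = IsTrunk⇒Names S-trunk in
  Names⇒IsTrunk {κ = φ κ} (names λ x → mk⇔
    (λ x∈pre → let x∈C , fx∈S = to (∈-preimage⇔ f C S) x∈pre in
      x∈C , subst T (pull f-pulls x x∈C κ) (to (Names⇒∈⇔ S-named (into x∈C)) fx∈S))
    (λ (x∈C , t) → from (∈-preimage⇔ f C S)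
      (x∈C , from (Names⇒∈⇔ S-named (into x∈C)) (subst T (sym (pull f-pulls x x∈C κ)) t))))

IsMorphism⇒Pulls : ∀ {C : Code n} {D : Code m} {f} → IsMorphism C D f → ∃ (Pulls C f)
IsMorphism⇒Pulls {n} {m} {C = C} {D} {f} (into , trunk-preimage) = φ , mkPulls pulls
  where
  pulled : ∀ σ → ∃[ κ ] Names C κ (preimage f C (Tk D σ))
  pulled σ = IsTrunk⇒Names (trunk-preimage (Tk D σ) (inj₂ (σ , λ _ → ⇔-id _)))

  φ : Key m → Key n
  φ nothing = nothing
  φ (just σ) = proj₁ (pulled σ)

  pulls : ∀ c → c ∈ C → ∀ k → f c ∈ᵏ k ≡ c ∈ᵏ φ k
  pulls c c∈C nothing = refl
  pulls c c∈C (just σ) = T-⇔⇒≡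
    (Names⇒∈⇔ (proj₂ (pulled σ)) c∈C ⇔-∘
      (∈-preimage-at ⇔-∘ ⇔-sym (Names⇒∈⇔ (Tk-Names D σ) (into c∈C))))
    where
    ∈-preimage-at : f c ∈ Tk D σ ⇔ c ∈ preimage f C (Tk D σ)
    ∈-preimage-at = mk⇔ (λ fc∈Tk → from (∈-preimage⇔ f C (Tk D σ)) (c∈C , fc∈Tk))
                        (proj₂ ∘ to (∈-preimage⇔ f C (Tk D σ)))

Pulls-∘ : ∀ {C : Code n} {D : Code m} {f g φ ψ} → MapsInto C D f → Pulls C f φ → Pulls D g ψ →
          Pulls {m = k} C (g ∘ f) (φ ∘ ψ)
Pulls-∘ {f = f} {ψ = ψ} into f-pulls g-pulls = mkPulls λ c c∈C k →
  trans (pull g-pulls (f c) (into c∈C) k) (pull f-pulls c c∈C (ψ k))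

Pulls-reflecting : ∀ {C : Code n} {D : Code m} {f φ} → Onto C D f → Pulls C f φ →
                   ∀ {k k′} → φ k ≈[ C ] φ k′ → k ≈[ D ] k′
Pulls-reflecting onto f-pulls {k} {k′} φk≈φk′ d d∈D with onto d∈D
... | c , c∈C , refl = trans (pull f-pulls c c∈C k) (trans (φk≈φk′ c c∈C) (sym (pull f-pulls c c∈C k′)))

Pulls-congruent : ∀ {C : Code n} {D : Code m} {f φ} → MapsInto C D f → Pulls C f φ →
                  ∀ {k k′} → k ≈[ D ] k′ → φ k ≈[ C ] φ k′
Pulls-congruent {f = f} into f-pulls {k} {k′} k≈k′ c c∈C =
  trans (sym (pull f-pulls c c∈C k)) (trans (k≈k′ (f c) (into c∈C)) (pull f-pulls c c∈C k′))

Pulls⇒trunkCount≤ : ∀ {C : Code n} {D : Code m} {f φ} → Onto C D f → Pulls C f φ → trunkCount D ≤ trunkCount C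
Pulls⇒trunkCount≤ {m = m} {C = C} {D} {φ = φ} onto f-pulls =
  classCount-≤ (trunkSetoid D) (trunkSetoid C) φ (Pulls-reflecting onto f-pulls) {keys m} ∈-keys

≐⇒≅ : ∀ {C D : Code n} → (∀ {x} → x ∈ C → x ∈ D) → (∀ {x} → x ∈ D → x ∈ C) → C ≅ D
≐⇒≅ C⊆D D⊆C =
  id , id , Pulls⇒IsMorphism C⊆D id-pulls , Pulls⇒IsMorphism D⊆C id-pulls , (λ _ → refl) , (λ _ → refl)
  where
  id-pulls : ∀ {C : Code n} → Pulls C id id
  id-pulls = mkPulls λ _ _ _ → refl

≅-refl : ∀ {C : Code n} → C ≅ C
≅-refl = ≐⇒≅ id id

≅-sym : ∀ {C : Code n} {D : Code m} → C ≅ D → D ≅ C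
≅-sym (f , g , f-mor , g-mor , g∘f , f∘g) = g , f , g-mor , f-mor , f∘g , g∘f

IsMorphism-∘ : ∀ {C : Code n} {D : Code m} {E : Code k} {f g} →
               IsMorphism C D f → IsMorphism D E g → IsMorphism C E (g ∘ f)
IsMorphism-∘ f-mor g-mor = Pulls⇒IsMorphism (proj₁ g-mor ∘ proj₁ f-mor)
  (Pulls-∘ (proj₁ f-mor) (proj₂ (IsMorphism⇒Pulls f-mor)) (proj₂ (IsMorphism⇒Pulls g-mor)))

≅-trans : ∀ {C : Code n} {D : Code m} {E : Code k} → C ≅ D → D ≅ E → C ≅ E
≅-trans (f , f⁻¹ , f-mor , f⁻¹-mor , f⁻¹∘f , f∘f⁻¹) (g , g⁻¹ , g-mor , g⁻¹-mor , g⁻¹∘g , g∘g⁻¹) =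
  g ∘ f , f⁻¹ ∘ g⁻¹ , IsMorphism-∘ f-mor g-mor , IsMorphism-∘ g⁻¹-mor f⁻¹-mor ,
  (λ c∈C → trans (cong f⁻¹ (g⁻¹∘g (proj₁ f-mor c∈C))) (f⁻¹∘f c∈C)) ,
  (λ e∈E → trans (cong g (f∘f⁻¹ (proj₁ g⁻¹-mor e∈E))) (g∘g⁻¹ e∈E))

≅⇒trunkCount≤ : ∀ {C : Code n} {D : Code m} → C ≅ D → trunkCount D ≤ trunkCount C
≅⇒trunkCount≤ (f , g , f-mor , g-mor , _ , f∘g) =
  Pulls⇒trunkCount≤ (λ d∈D → _ , proj₁ g-mor d∈D , f∘g d∈D) (proj₂ (IsMorphism⇒Pulls f-mor))

≅⇒trunkCount≡ : ∀ {C : Code n} {D : Code m} → C ≅ D → trunkCount C ≡ trunkCount D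
≅⇒trunkCount≡ C≅D = ≤-antisym (≅⇒trunkCount≤ (≅-sym C≅D)) (≅⇒trunkCount≤ C≅D)

-- Operations do not increase the number of trunks

image-Onto : ∀ f (C : Code n) → Onto {m = m} C (image f C) f
image-Onto f C d∈fC = let c , c∈C , d≡fc = ∈-map⁻ f d∈fC in c , c∈C , sym d≡fc

invertOn : (Subset n → Subset m) → Code n → Subset m → Subset n
invertOn f [] d = ∅
invertOn f (c ∷ C) d with f c ≟ˢ d
... | yes _ = c
... | no _ = invertOn f C d

invertOn-correct : ∀ f (C : Code n) {d : Subset m} → d ∈ image f C → invertOn f C d ∈ C × f (invertOn f C d) ≡ d
invertOn-correct f (c ∷ C) {d} d∈fC with f c ≟ˢ d | d∈fC
... | yes fc≡d | _ = here refl , fc≡d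
... | no fc≢d | here d≡fc = ⊥-elim (fc≢d (sym d≡fc))
... | no _ | there d∈fC′ = let c′∈C , fc′≡d = invertOn-correct f C d∈fC′ in there c′∈C , fc′≡d

module _ {C : Code n} {h : Subset n → Subset m} {φ : Key m → Key n} (h-pulls : Pulls C h φ) where

  image-IsMorphism : IsMorphism C (image h C) h
  image-IsMorphism = Pulls⇒IsMorphism (∈-map⁺ h) h-pulls

  image-≤ᶜ : image h C ≤ᶜ C
  image-≤ᶜ = _ , image h C , step done (morphOp (image h C) h image-IsMorphism) , ≅-refl

  image-trunkCount≤ : trunkCount (image h C) ≤ trunkCount C
  image-trunkCount≤ = Pulls⇒trunkCount≤ (image-Onto h C) h-pulls

  module _ (φ-surjective : ∀ κ → ∃[ k ] κ ≈[ C ] φ k) where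

    image-injective : ∀ {c c′} → c ∈ C → c′ ∈ C → h c ≡ h c′ → c ≡ c′
    image-injective {c} {c′} c∈C c′∈C hc≡hc′ = Subset-ext λ j →
      let k , ⁅j⁆≈φk = φ-surjective (just ⁅ j ⁆) in begin
        c ∈ᵏ just ⁅ j ⁆   ≡⟨ ⁅j⁆≈φk c c∈C ⟩
        c ∈ᵏ φ k          ≡⟨ sym (pull h-pulls c c∈C k) ⟩
        h c ∈ᵏ k          ≡⟨ cong (_∈ᵏ k) hc≡hc′ ⟩
        h c′ ∈ᵏ k         ≡⟨ pull h-pulls c′ c′∈C k ⟩
        c′ ∈ᵏ φ k         ≡⟨ sym (⁅j⁆≈φk c′ c′∈C) ⟩
        c′ ∈ᵏ just ⁅ j ⁆  ∎

    image-≅ : C ≅ image h C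
    image-≅ = h , g , image-IsMorphism , Pulls⇒IsMorphism g-into g-pulls , g∘h , h∘g
      where
      g : Subset m → Subset n
      g = invertOn h C

      g-into : MapsInto (image h C) C g
      g-into = proj₁ ∘ invertOn-correct h C

      h∘g : ∀ {d} → d ∈ image h C → h (g d) ≡ d
      h∘g = proj₂ ∘ invertOn-correct h C

      g∘h : ∀ {c} → c ∈ C → g (h c) ≡ c
      g∘h c∈C = image-injective (g-into (∈-map⁺ h c∈C)) c∈C (h∘g (∈-map⁺ h c∈C))

      g-pulls : Pulls (image h C) g (proj₁ ∘ φ-surjective)
      g-pulls = mkPulls λ d d∈hC κ → let k , κ≈φk = φ-surjective κ in begin
        g d ∈ᵏ κ      ≡⟨ κ≈φk (g d) (g-into d∈hC) ⟩
        g d ∈ᵏ φ k    ≡⟨ sym (pull h-pulls (g d) (g-into d∈hC) k) ⟩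
        h (g d) ∈ᵏ k  ≡⟨ cong (_∈ᵏ k) (h∘g d∈hC) ⟩
        d ∈ᵏ k        ∎

  image-trunkCount≡⇒≅ : trunkCount (image h C) ≡ trunkCount C → C ≅ image h C
  image-trunkCount≡⇒≅ same = image-≅ (classCount-≡⇒surjective (trunkSetoid (image h C)) (trunkSetoid C) φ
    (Pulls-reflecting (image-Onto h C) h-pulls) ∈-keys ∈-keys same)

_∩ᵏ_ : Key n → Key n → Key n
nothing ∩ᵏ _ = nothing
just σ ∩ᵏ nothing = nothing
just σ ∩ᵏ just τ = just (σ ∪ τ)

∈ᵏ-∩ : ∀ (c : Subset n) k k′ → c ∈ᵏ (k ∩ᵏ k′) ≡ c ∈ᵏ k ∧ c ∈ᵏ k′
∈ᵏ-∩ c nothing k′ = refl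
∈ᵏ-∩ c (just σ) nothing = sym (∧-zeroʳ _)
∈ᵏ-∩ c (just σ) (just τ) = T-⇔⇒≡
  (⇔-sym T-∧ ⇔-∘
    (⇔-sym (T-does⇔ (σ ⊆? c) ×-⇔ T-does⇔ (τ ⊆? c)) ⇔-∘ (∪⊆⇔ ⇔-∘ T-does⇔ ((σ ∪ τ) ⊆? c))))

module _ {C S : Code n} {κ : Key n} (S-named : Names C κ S) where

  ∩ᵏ-restricts : ∀ {x} k → x ∈ S → x ∈ᵏ (k ∩ᵏ κ) ≡ x ∈ᵏ k
  ∩ᵏ-restricts {x} k x∈S =
    trans (∈ᵏ-∩ x k κ)
      (trans (cong (x ∈ᵏ k ∧_) (to T-≡ (proj₂ (to (∈⇔ S-named x) x∈S)))) (∧-identityʳ _))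

  ∩ᵏ-reflecting : ∀ {k k′} → (k ∩ᵏ κ) ≈[ C ] (k′ ∩ᵏ κ) → k ≈[ S ] k′
  ∩ᵏ-reflecting {k} {k′} same x x∈S =
    trans (sym (∩ᵏ-restricts k x∈S))
      (trans (same x (proj₁ (to (∈⇔ S-named x) x∈S))) (∩ᵏ-restricts k′ x∈S))

  trunk-trunkCount≤ : trunkCount S ≤ trunkCount C
  trunk-trunkCount≤ = classCount-≤ (trunkSetoid S) (trunkSetoid C) (_∩ᵏ κ)
    (λ {k} {k′} → ∩ᵏ-reflecting {k} {k′}) {keys n} ∈-keys

  -- Equal counts make Tk(∅) = C agree on C with some k ∩ᵏ κ, so all of C lies in S.
  trunk-trunkCount≡⇒≅ : trunkCount S ≡ trunkCount C → C ≅ S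
  trunk-trunkCount≡⇒≅ same = ≐⇒≅ C⊆S (proj₁ ∘ to (∈⇔ S-named _))
    where
    C⊆S : ∀ {x} → x ∈ C → x ∈ S
    C⊆S {x} x∈C with classCount-≡⇒surjective (trunkSetoid S) (trunkSetoid C) (_∩ᵏ κ)
                       (λ {k} {k′} → ∩ᵏ-reflecting {k} {k′}) ∈-keys ∈-keys same (just ∅)
    ... | k , C≈k∩κ = from (Names⇒∈⇔ S-named x∈C) (proj₂ (to T-∧
      (subst T (trans (C≈k∩κ x x∈C) (∈ᵏ-∩ x k κ)) (from (T-does⇔ (∅ ⊆? x)) ⊥⊆))))

Op⇒trunkCount≤ : ∀ {C : Code n} {E : Code m} → Op C E → trunkCount E ≤ trunkCount C
Op⇒trunkCount≤ (trunkOp S S-trunk) = trunk-trunkCount≤ (proj₂ (IsTrunk⇒Names S-trunk))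
Op⇒trunkCount≤ (morphOp D f f-mor) = image-trunkCount≤ (proj₂ (IsMorphism⇒Pulls f-mor))

Op-trunkCount≡⇒≅ : ∀ {C : Code n} {E : Code m} → Op C E → trunkCount E ≡ trunkCount C → C ≅ E
Op-trunkCount≡⇒≅ (trunkOp S S-trunk) = trunk-trunkCount≡⇒≅ (proj₂ (IsTrunk⇒Names S-trunk))
Op-trunkCount≡⇒≅ (morphOp D f f-mor) = image-trunkCount≡⇒≅ (proj₂ (IsMorphism⇒Pulls f-mor))

Ops⇒trunkCount≤ : ∀ {C : Code n} {E : Code m} → Ops C E → trunkCount E ≤ trunkCount C
Ops⇒trunkCount≤ done = ≤-refl
Ops⇒trunkCount≤ (step ops op) = ≤-trans (Op⇒trunkCount≤ op) (Ops⇒trunkCount≤ ops)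

Ops-trunkCount≡⇒≅ : ∀ {C : Code n} {E : Code m} → Ops C E → trunkCount E ≡ trunkCount C → C ≅ E
Ops-trunkCount≡⇒≅ done _ = ≅-refl
Ops-trunkCount≡⇒≅ {C = C} (step {D = D} ops op) E≡C =
  ≅-trans (Ops-trunkCount≡⇒≅ ops D≡C) (Op-trunkCount≡⇒≅ op (trans E≡C (sym D≡C)))
  where
  D≡C : trunkCount D ≡ trunkCount C
  D≡C = ≤-antisym (Ops⇒trunkCount≤ ops) (subst (_≤ trunkCount D) E≡C (Op⇒trunkCount≤ op))

≤ᶜ⇒trunkCount≤ : ∀ {D : Code n} {C : Code m} → D ≤ᶜ C → trunkCount D ≤ trunkCount C
≤ᶜ⇒trunkCount≤ {C = C} (_ , _ , ops , E≅D) =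
  subst (_≤ trunkCount C) (≅⇒trunkCount≡ E≅D) (Ops⇒trunkCount≤ ops)

<ᶜ⇒trunkCount< : ∀ {D : Code n} {C : Code m} → D <ᶜ C → trunkCount D < trunkCount C
<ᶜ⇒trunkCount< (D≤C@(_ , _ , ops , E≅D) , D≇C) = ≤∧≢⇒< (≤ᶜ⇒trunkCount≤ D≤C) λ D≡C →
  D≇C (≅-sym (≅-trans (Ops-trunkCount≡⇒≅ ops (trans (≅⇒trunkCount≡ E≅D) D≡C)) E≅D))

trunkCount≡suc⇒Covers : ∀ {C : Code n} {D : Code m} → D ≤ᶜ C → trunkCount C ≡ suc (trunkCount D) → Covers C D
trunkCount≡suc⇒Covers {C = C} {D} D≤C count = (D≤C , D≇C) , nothing-between
  where
  D≇C : ¬ D ≅ C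
  D≇C D≅C = 1+n≢n (sym (trans (≅⇒trunkCount≡ D≅C) count))

  nothing-between : ¬ (∃[ k ] ∃[ E ] (D <ᶜ E) × (E <ᶜ C))
  nothing-between (_ , E , D<E , E<C) =
    1+n≰n (≤-trans (<ᶜ⇒trunkCount< D<E) (s≤s⁻¹ (subst (suc (trunkCount E) ≤_) count (<ᶜ⇒trunkCount< E<C))))

∈-determined⇔ : ∀ (L : List (Subset n)) {c p} → p ∈ˢ determined L c ⇔ lookup L p ⊆ˢ c
∈-determined⇔ L {c} {p} = T-does⇔ (lookup L p ⊆? c) ⇔-∘ ∈-tabulate⇔

⋃[_] : (L : List (Subset n)) → Subset (length L) → Subset n
⋃[ L ] σ′ = tabulate λ j → does (FinP.any? λ p → p ∈ˢ? σ′ ×-dec j ∈ˢ? lookup L p)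

∈-⋃⇔ : ∀ (L : List (Subset n)) {σ′ j} → j ∈ˢ ⋃[ L ] σ′ ⇔ (∃[ p ] p ∈ˢ σ′ × j ∈ˢ lookup L p)
∈-⋃⇔ L {σ′} {j} = T-does⇔ (FinP.any? λ p → p ∈ˢ? σ′ ×-dec j ∈ˢ? lookup L p) ⇔-∘ ∈-tabulate⇔

lookup⊆⋃ : ∀ (L : List (Subset n)) {σ′ p} → p ∈ˢ σ′ → lookup L p ⊆ˢ ⋃[ L ] σ′
lookup⊆⋃ L {p = p} p∈σ′ j∈Lp = from (∈-⋃⇔ L) (p , p∈σ′ , j∈Lp)

⋃⊆⇔⊆determined : ∀ (L : List (Subset n)) {σ′ c} → ⋃[ L ] σ′ ⊆ˢ c ⇔ σ′ ⊆ˢ determined L c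
⋃⊆⇔⊆determined L = mk⇔
  (λ ⋃⊆c {p} p∈σ′ → from (∈-determined⇔ L) λ j∈Lp → ⋃⊆c (lookup⊆⋃ L p∈σ′ j∈Lp))
  (λ σ′⊆ {j} j∈⋃ → let p , p∈σ′ , j∈Lp = to (∈-⋃⇔ L) j∈⋃ in
    to (∈-determined⇔ L) (σ′⊆ p∈σ′) j∈Lp)

pullDetermined : (L : List (Subset n)) → Key (length L) → Key n
pullDetermined L nothing = nothing
pullDetermined L (just σ′) = just (⋃[ L ] σ′)

determined-Pulls : ∀ (C : Code n) L → Pulls C (determined L) (pullDetermined L)
determined-Pulls C L = mkPulls λ where
  c _ nothing → refl
  c _ (just σ′) → does-⇔ (⇔-sym (⋃⊆⇔⊆determined L)) (σ′ ⊆? determined L c) (⋃[ L ] σ′ ⊆? c)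

Generated : List (Subset n) → Subset n → Set
Generated L σ = ∀ {j} → j ∈ˢ σ → ∃[ τ ] τ ∈ L × j ∈ˢ τ × τ ⊆ˢ σ

⋃-determined : ∀ (L : List (Subset n)) {σ} → Generated L σ → ⋃[ L ] (determined L σ) ≡ σ
⋃-determined L {σ} generated = ⊆-antisym (from (⋃⊆⇔⊆determined L) id) σ⊆⋃
  where
  σ⊆⋃ : σ ⊆ˢ ⋃[ L ] (determined L σ)
  σ⊆⋃ j∈σ with generated j∈σ
  ... | τ , τ∈L , j∈τ , τ⊆σ = from (∈-⋃⇔ L)
    ( Any.index τ∈L
    , from (∈-determined⇔ L) (subst (_⊆ˢ _) (lookup-index τ∈L) τ⊆σ)
    , subst (_ ∈ˢ_) (lookup-index τ∈L) j∈τ )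

Generated⇒pulled : ∀ (C : Code n) L {σ} → Generated L σ → ∃[ k ] just σ ≈[ C ] pullDetermined L k
Generated⇒pulled C L generated =
  just (determined L _) , λ c _ → cong (λ τ → c ∈ᵏ just τ) (sym (⋃-determined L generated))

-- The covered code

Separates : Code n → Fin n → Fin n → Set
Separates C i j = ¬ (just (⁅ i ⁆ ∪ ⁅ j ⁆) ≈[ C ] just ⁅ i ⁆)

Separates-irrefl : ∀ (C : Code n) i → ¬ Separates C i i
Separates-irrefl C i separates = separates λ c _ → cong (λ τ → c ∈ᵏ just τ) (∪-idem ⁅ i ⁆)

-- Definitionally the list `js` local to `coveredSigmas`.
others : Fin n → List (Fin n)
others {n} i = filterᵇ (λ j → not (does (j Fin.≟ i))) (allFin n)

∈-others⇔ : ∀ {i j : Fin n} → j ∈ others i ⇔ j ≢ i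
∈-others⇔ {i = i} {j} = mk⇔
  (λ j∈ → to T-not⇔¬T (proj₂ (∈-filter⁻ (T? ∘ _) {xs = allFin _} j∈)) ∘ from (T-does⇔ (j Fin.≟ i)))
  (λ j≢i → ∈-filter⁺ (T? ∘ _) (∈-allFin j) (from T-not⇔¬T (j≢i ∘ to (T-does⇔ (j Fin.≟ i)))))

module _ {n} (C : Code n) (i : Fin n) where
  private
    L : List (Subset n)
    L = coveredSigmas C i

  T-separates⇔ : ∀ {j} → T (not (sameTkᵇ C (⁅ i ⁆ ∪ ⁅ j ⁆) ⁅ i ⁆)) ⇔ Separates C i j
  T-separates⇔ {j} = mk⇔
    (λ t → to T-not⇔¬T t ∘ from (T-sameTkᵇ⇔ C (⁅ i ⁆ ∪ ⁅ j ⁆) ⁅ i ⁆))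
    (λ separates → from T-not⇔¬T (separates ∘ to (T-sameTkᵇ⇔ C (⁅ i ⁆ ∪ ⁅ j ⁆) ⁅ i ⁆)))

  ⁅⁆∈coveredSigmas : ∀ {j} → j ≢ i → ⁅ j ⁆ ∈ L
  ⁅⁆∈coveredSigmas j≢i = ∈-++⁺ˡ (∈-map⁺ ⁅_⁆ (from ∈-others⇔ j≢i))

  pair∈coveredSigmas : ∀ {j} → Separates C i j → ⁅ i ⁆ ∪ ⁅ j ⁆ ∈ L
  pair∈coveredSigmas {j} separates = ∈-++⁺ʳ (map ⁅_⁆ (others i)) (∈-map⁺ (λ j → ⁅ i ⁆ ∪ ⁅ j ⁆)
    (∈-filter⁺ (T? ∘ _) (from ∈-others⇔ j≢i) (from T-separates⇔ separates)))
    where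
    j≢i : j ≢ i
    j≢i refl = Separates-irrefl C i separates

  ∈-coveredSigmas⁻ : ∀ {τ} → τ ∈ L →
                     (∃[ j ] j ≢ i × τ ≡ ⁅ j ⁆) ⊎ (∃[ j ] Separates C i j × τ ≡ ⁅ i ⁆ ∪ ⁅ j ⁆)
  ∈-coveredSigmas⁻ τ∈L with ∈-++⁻ (map ⁅_⁆ (others i)) τ∈L
  ... | inj₁ τ∈singletons = let j , j∈others , τ≡⁅j⁆ = ∈-map⁻ ⁅_⁆ τ∈singletons in
    inj₁ (j , to ∈-others⇔ j∈others , τ≡⁅j⁆)
  ... | inj₂ τ∈pairs = let j , j∈separating , τ≡pair = ∈-map⁻ (λ j → ⁅ i ⁆ ∪ ⁅ j ⁆) τ∈pairs in
    inj₂ (j , to T-separates⇔ (proj₂ (∈-filter⁻ (T? ∘ _) {xs = others i} j∈separating)) , τ≡pair)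

  ⁅i⁆-not-pulled : Reduced C → ∀ k → ¬ just ⁅ i ⁆ ≈[ C ] pullDetermined L k
  ⁅i⁆-not-pulled reduced nothing same = proj₁ (reduced i) λ x x∈Tk →
    let x∈C , t = to (∈⇔ (Tk-Names C ⁅ i ⁆) x) x∈Tk in subst T (same x x∈C) t
  ⁅i⁆-not-pulled reduced (just σ′) same with i ∈ˢ? ⋃[ L ] σ′
  ... | no i∉⋃ = proj₂ (reduced i) (⋃[ L ] σ′ , i∉⋃ , ≈⇒Tk≐ same)
  ... | yes i∈⋃ with to (∈-⋃⇔ L) i∈⋃
  ...   | p , p∈σ′ , i∈Lp with ∈-coveredSigmas⁻ (∈-lookup p)
  ...     | inj₁ (j , j≢i , Lp≡⁅j⁆) = j≢i (sym (x∈⁅y⁆⇒x≡y j (subst (i ∈ˢ_) Lp≡⁅j⁆ i∈Lp)))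
  ...     | inj₂ (j , separates , Lp≡pair) = separates
    (Tk-sandwich (p⊆p∪q ⁅ j ⁆) (subst (_⊆ˢ ⋃[ L ] σ′) Lp≡pair (lookup⊆⋃ L p∈σ′)) same)

  ∉⇒Generated : ∀ {σ} → i ∉ˢ σ → Generated L σ
  ∉⇒Generated i∉σ {j} j∈σ = ⁅ j ⁆ , ⁅⁆∈coveredSigmas (λ { refl → i∉σ j∈σ }) , x∈⁅x⁆ j , from ⁅⁆⊆⇔∈ j∈σ

  separated⇒Generated : ∀ {σ j} → i ∈ˢ σ → j ∈ˢ σ → Separates C i j → Generated L σ
  separated⇒Generated {σ} {j} i∈σ j∈σ separates {j′} j′∈σ with j′ Fin.≟ i
  ... | yes refl = ⁅ i ⁆ ∪ ⁅ j ⁆ , pair∈coveredSigmas separates , p⊆p∪q ⁅ j ⁆ (x∈⁅x⁆ i) ,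
                   from ∪⊆⇔ (from ⁅⁆⊆⇔∈ i∈σ , from ⁅⁆⊆⇔∈ j∈σ)
  ... | no j′≢i = ⁅ j′ ⁆ , ⁅⁆∈coveredSigmas j′≢i , x∈⁅x⁆ j′ , from ⁅⁆⊆⇔∈ j′∈σ

  unseparated⇒≈⁅i⁆ : ∀ {σ} → i ∈ˢ σ → (∀ {j} → j ∈ˢ σ → ¬ Separates C i j) → just σ ≈[ C ] just ⁅ i ⁆
  unseparated⇒≈⁅i⁆ {σ} i∈σ unseparated c c∈C = T-⇔⇒≡ (mk⇔
    (λ t → from (T-does⇔ (⁅ i ⁆ ⊆? c)) (⊆-trans (from ⁅⁆⊆⇔∈ i∈σ) (to (T-does⇔ (σ ⊆? c)) t)))
    (λ t → from (T-does⇔ (σ ⊆? c)) (σ⊆c (to (T-does⇔ (⁅ i ⁆ ⊆? c)) t))))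
    where
    σ⊆c : ⁅ i ⁆ ⊆ˢ c → σ ⊆ˢ c
    σ⊆c ⁅i⁆⊆c {j} j∈σ = to (T-does⇔ ((⁅ i ⁆ ∪ ⁅ j ⁆) ⊆? c)) pair⊆c (q⊆p∪q ⁅ i ⁆ ⁅ j ⁆ (x∈⁅x⁆ j))
      where
      pair≈⁅i⁆ : just (⁅ i ⁆ ∪ ⁅ j ⁆) ≈[ C ] just ⁅ i ⁆
      pair≈⁅i⁆ = decidable-stable (≈[]-dec C (just (⁅ i ⁆ ∪ ⁅ j ⁆)) (just ⁅ i ⁆)) (unseparated j∈σ)

      pair⊆c : T (c ∈ᵏ just (⁅ i ⁆ ∪ ⁅ j ⁆))
      pair⊆c = subst T (sym (pair≈⁅i⁆ c c∈C)) (from (T-does⇔ (⁅ i ⁆ ⊆? c)) ⁅i⁆⊆c)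

  ⁅i⁆-or-pulled : ∀ κ → κ ≈[ C ] just ⁅ i ⁆ ⊎ ∃[ k ] κ ≈[ C ] pullDetermined L k
  ⁅i⁆-or-pulled nothing = inj₂ (nothing , λ _ _ → refl)
  ⁅i⁆-or-pulled (just σ) with i ∈ˢ? σ
  ... | no i∉σ = inj₂ (Generated⇒pulled C L (∉⇒Generated i∉σ))
  ... | yes i∈σ with FinP.any? (λ j → j ∈ˢ? σ ×-dec ¬? (≈[]-dec C (just (⁅ i ⁆ ∪ ⁅ j ⁆)) (just ⁅ i ⁆)))
  ...   | yes (j , j∈σ , separates) = inj₂ (Generated⇒pulled C L (separated⇒Generated i∈σ j∈σ separates))
  ...   | no none = inj₁ (unseparated⇒≈⁅i⁆ i∈σ λ j∈σ separates → none (_ , j∈σ , separates))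

  trunkCount-covered : Reduced C → trunkCount C ≡ suc (trunkCount (covered C i))
  trunkCount-covered reduced = ≤-antisym
    (classCount-≤-suc (trunkSetoid (covered C i)) (trunkSetoid C) (pullDetermined L)
      (λ {k} {k′} → Pulls-congruent (∈-map⁺ (determined L)) L-pulls {k} {k′}) {keys _} {keys n} ∈-keys
      (just ⁅ i ⁆) ⁅i⁆-or-pulled)
    (classCount-< (trunkSetoid (covered C i)) (trunkSetoid C) (pullDetermined L)
      (λ {k} {k′} → Pulls-reflecting (image-Onto (determined L) C) L-pulls {k} {k′}) {keys _} ∈-keys
      (just ⁅ i ⁆) (⁅i⁆-not-pulled reduced))
    where
    L-pulls : Pulls C (determined L) (pullDetermined L)
    L-pulls = determined-Pulls C L

theorem3p20 : ∀ (n : ℕ) (C : Code n) → Reduced C → (i : Fin n) →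
    Covers C (covered C i)
theorem3p20 n C reduced i =
  trunkCount≡suc⇒Covers (image-≤ᶜ (determined-Pulls C (coveredSigmas C i))) (trunkCount-covered C i reduced)
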